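{- Let $\mathbf{\Omega}$ be a chain and $f\in F(\mathbf{\Omega})$. Then $\overline{f}$ is a well-defined map on $\overline{\Omega}$ and $\overline{f}\in F(\overline{\mathbf{\Omega}})$.
   Context: For a map $f$ on a chain, $f^{r}$ is its residual ($f(a)\le b\iff a\le f^{r}(b)$), $f^{\ell}$ its dual residual ($f^{\ell}(a)\le b\iff a\le f(b)$); $F(\mathbf{\Omega})$ is the set of order-preserving maps on $\Omega$ with residuals and dual residuals of all orders. $\Omega^{ - }=\{a: a=\bigvee\{b:b<a\}\}$, $\Omega^{+}=\{a: a=\bigwedge\{b:a<b\}\}$. $\overline{\Omega}=\Omega\cup\{(k,a):a\in\Omega^{+},k\in\mathbb{Z}^{+}\}\cup\{(-k,a):a\in\Omega^{ - },k\in\mathbb{Z}^{+}\}$, each $a\in\Omega$ identified with $(0,a)$; writing $ka$ for $(k,a)$, $ka\le nb$ iff $a<b$ or ($a=b$ and $k\le n$). For $f\in F(\mathbf{\Omega})$ and $kb\in\overline{\Omega}$: $\overline{f}(kb)=f(b)$ if $|f^{ -1}[f(b)]|>1$ or $k=0$, and $\overline{f}(kb)=(k,f(b))$ if $|f^{ -1}[f(b)]|=1$ and $k\ne0$. -}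

module Defs where

open import Data.Nat using (ℕ; zero; suc)
open import Data.Integer using (ℤ; +_; _<_) renaming (_≤_ to _≤ℤ_)
open import Data.Product using (Σ; ∃; _×_; _,_)
open import Data.Sum using (_⊎_)
open import Relation.Nullary using (¬_)
open import Relation.Binary.PropositionalEquality using (_≡_; _≢_)

module _ {X : Set} (_≤_ : X → X → Set) where

  _<ₓ_ : X → X → Set
  a <ₓ b = (a ≤ b) × (a ≢ b)

  OrderPreserving : (X → X) → Set
  OrderPreserving f = ∀ {a b} → a ≤ b → f a ≤ f b

  IsResidual : (X → X) → (X → X) → Set
  IsResidual f g = ∀ a b → (f a ≤ b → a ≤ g b) × (a ≤ g b → f a ≤ b)

  IsDualResidual : (X → X) → (X → X) → Set
  IsDualResidual f g = ∀ a b → (g a ≤ b → a ≤ f b) × (a ≤ f b → g a ≤ b)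

  -- F(X): order-preserving maps having residuals and dual residuals of all
  -- orders.  r n = f^{r^(n+1)},  l n = f^{ℓ^(n+1)}.
  InF : (X → X) → Set
  InF f =
    OrderPreserving f
    × (Σ (ℕ → X → X) λ r →
         IsResidual f (r 0) × (∀ n → IsResidual (r n) (r (suc n))))
    × (Σ (ℕ → X → X) λ l →
         IsDualResidual f (l 0) × (∀ n → IsDualResidual (l n) (l (suc n))))

  IsSup : (X → Set) → X → Set
  IsSup S a = (∀ s → S s → s ≤ a) × (∀ u → (∀ s → S s → s ≤ u) → a ≤ u)

  IsInf : (X → Set) → X → Set
  IsInf S a = (∀ s → S s → a ≤ s) × (∀ u → (∀ s → S s → u ≤ s) → u ≤ a)

  Down : X → Set
  Down a = IsSup (λ b → b <ₓ a) a

  Up : X → Set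
  Up a = IsInf (λ b → a <ₓ b) a

module _ {A : Set} (_≤_ : A → A → Set) where

  -- (k , a) is an element of Ω̄ : k = 0 (a ∈ Ω, identified with (0,a)),
  -- or k > 0 and a ∈ Ω⁺, or k < 0 and a ∈ Ω⁻.
  ValidBar : ℤ → A → Set
  ValidBar k a = (+ 0 < k → Up _≤_ a) × (k < + 0 → Down _≤_ a)

  -- elements of Ω̄; the membership proof is irrelevant, so elements are
  -- equal iff their index and point are equal.
  record Bar : Set where
    constructor bar
    field
      idx : ℤ
      pt  : A
      .valid : ValidBar idx pt

  open Bar public

  _≤Bar_ : Bar → Bar → Set
  x ≤Bar y = (_<ₓ_ _≤_ (pt x) (pt y)) ⊎ ((pt x ≡ pt y) × (idx x ≤ℤ idx y))

  FiberNonSingleton : (A → A) → A → Set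
  FiberNonSingleton f b = ∃ λ c → (f c ≡ f b) × (c ≢ b)

  -- |f⁻¹[f(b)]| = 1  (b itself always lies in the fibre)
  FiberSingleton : (A → A) → A → Set
  FiberSingleton f b = ∀ c → f c ≡ f b → c ≡ b

  FBarGraph : (A → A) → Bar → Bar → Set
  FBarGraph f x y =
      ((FiberNonSingleton f (pt x) ⊎ idx x ≡ + 0)
         × idx y ≡ + 0 × pt y ≡ f (pt x))
    ⊎ (FiberSingleton f (pt x) × idx x ≢ + 0
         × idx y ≡ idx x × pt y ≡ f (pt x))

{-# OPTIONS --safe #-}
-- A map in F(Ω) sits at position 0 of a bi-infinite chain of residuated maps
-- … ⊣ f^ℓ ⊣ f ⊣ f^r ⊣ …, and conversely.  Lifting every map of the chain to
-- Ω̄ gives again such a chain, because for f ⊣ h the lifted maps satisfy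
-- f̄(ka) ≤ nb ⇔ ka ≤ h̄(nb).  On the points the equivalence is residuation in
-- Ω; the indices only matter when f a = b or a = h b, and there the key fact
-- is: if g has a left adjoint which itself has a left adjoint, then
-- g b ∈ Ω⁺ forces the fibre of g through b to be {b} (dually for Ω⁻).  This
-- pins down the sign of the indices whenever a fibre is not a singleton,
-- and it is why residuals two steps away from f, hence of all orders, are needed.
module Submission where

open import Defs
open import Data.Product using (Σ; _×_; _,_; proj₁; proj₂)
open import Data.Sum using (_⊎_; inj₁; inj₂; [_,_]′)
open import Data.Empty using (⊥-elim)
open import Data.Nat using (zero; suc)
open import Data.Integer using (ℤ; +_; -[1+_]; +<+)
  renaming (_≤_ to _≤ℤ_; suc to sucℤ; pred to predℤ)
import Data.Integer.Properties as ℤ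
open import Function using (id; const; _∘_)
open import Relation.Nullary using (¬_; yes; no)
open import Relation.Nullary.Decidable using (recompute)
open import Relation.Binary.PropositionalEquality
  using (_≡_; refl; sym; trans; cong; subst; isEquivalence; module ≡-Reasoning)
open import Relation.Binary.Structures using (IsPreorder; IsTotalOrder)
open import Axiom.ExcludedMiddle using (ExcludedMiddle)
open import Level using (0ℓ)

ResiduatedChain : {X : Set} (_≼_ : X → X → Set) → (ℤ → X → X) → Set
ResiduatedChain _≼_ s = ∀ i → IsResidual _≼_ (s i) (s (sucℤ i))

module Residuation {X : Set} (_≼_ : X → X → Set) where

  residual-preserves-inf : ∀ {l f S a w} → IsResidual _≼_ l f → IsInf _≼_ S a →
                           (∀ s → S s → w ≼ f s) → w ≼ f a
  residual-preserves-inf {l} {a = a} {w} l⊣f (_ , greatest) w≼fS =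
    proj₁ (l⊣f w a) (greatest (l w) λ s Ss → proj₂ (l⊣f w s) (w≼fS s Ss))

  residuated-preserves-sup : ∀ {f h S b u} → IsResidual _≼_ f h → IsSup _≼_ S b →
                             (∀ s → S s → f s ≼ u) → f b ≼ u
  residuated-preserves-sup {h = h} {b = b} {u} f⊣h (_ , least) fS≼u =
    proj₂ (f⊣h b u) (least (h u) λ s Ss → proj₁ (f⊣h s u) (fS≼u s Ss))

  chain : ∀ {f} → InF _≼_ f → ℤ → X → X
  chain {f} _ (+ zero) = f
  chain (_ , (r , _) , _) (+ suc n) = r n
  chain (_ , _ , (l , _)) -[1+ n ] = l n

  chain-residuated : ∀ {f} (F : InF _≼_ f) → ResiduatedChain _≼_ (chain F)
  chain-residuated (_ , (_ , f⊣r₀ , _) , _) (+ zero) = f⊣r₀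
  chain-residuated (_ , (_ , _ , rₙ⊣rₙ₊₁) , _) (+ suc n) = rₙ⊣rₙ₊₁ n
  chain-residuated (_ , _ , (_ , l₀⊣f , _)) -[1+ zero ] = l₀⊣f
  chain-residuated (_ , _ , (_ , _ , lₙ₊₁⊣lₙ)) -[1+ suc n ] = lₙ₊₁⊣lₙ n

  residuated-pred : ∀ {s} → ResiduatedChain _≼_ s → ∀ i → IsResidual _≼_ (s (predℤ i)) (s i)
  residuated-pred {s} res i =
    subst (λ j → IsResidual _≼_ (s (predℤ i)) (s j)) (ℤ.suc-pred i) (res (predℤ i))

  module _ (≼-isPreorder : IsPreorder _≡_ _≼_) where
    open IsPreorder ≼-isPreorder using () renaming (refl to ≼-refl; trans to ≼-trans)

    residual-unit : ∀ {f h a} → IsResidual _≼_ f h → a ≼ h (f a)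
    residual-unit {f} {a = a} f⊣h = proj₁ (f⊣h a (f a)) ≼-refl

    residual-counit : ∀ {f h b} → IsResidual _≼_ f h → f (h b) ≼ b
    residual-counit {h = h} {b} f⊣h = proj₂ (f⊣h (h b) b) ≼-refl

    residuated-monotone : ∀ {f h} → IsResidual _≼_ f h → OrderPreserving _≼_ f
    residuated-monotone {f} f⊣h {a} {b} a≼b =
      proj₂ (f⊣h a (f b)) (≼-trans a≼b (residual-unit f⊣h))

    residual-monotone : ∀ {f h} → IsResidual _≼_ f h → OrderPreserving _≼_ h
    residual-monotone {h = h} f⊣h {a} {b} a≼b =
      proj₁ (f⊣h (h a) b) (≼-trans (residual-counit f⊣h) a≼b)

    chain⇒InF : ∀ {s} → ResiduatedChain _≼_ s → InF _≼_ (s (+ 0))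
    chain⇒InF {s} res =
        residuated-monotone (res (+ 0))
      , ((λ n → s (+ suc n)) , res (+ 0) , λ n → res (+ suc n))
      , ((λ n → s -[1+ n ]) , res -[1+ 0 ] , λ n → res -[1+ suc n ])

module OnChain (em : ExcludedMiddle 0ℓ) {A : Set} {_≤_ : A → A → Set}
             (≤-isTotalOrder : IsTotalOrder _≡_ _≤_) where
  open IsTotalOrder ≤-isTotalOrder
    using (isPreorder; total) renaming (refl to ≤-refl; trans to ≤-trans; antisym to ≤-antisym)
  open Residuation _≤_

  _<_ : A → A → Set
  _<_ = _<ₓ_ _≤_

  Ω⁺ Ω⁻ : A → Set
  Ω⁺ = Up _≤_
  Ω⁻ = Down _≤_

  Sing : (A → A) → A → Set
  Sing = FiberSingleton _≤_

  Ω̄ : Set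
  Ω̄ = Bar _≤_

  _≤̄_ : Ω̄ → Ω̄ → Set
  _≤̄_ = _≤Bar_ _≤_

  <⇒≱ : ∀ {a b} → a < b → ¬ b ≤ a
  <⇒≱ (a≤b , a≢b) b≤a = a≢b (≤-antisym a≤b b≤a)

  ≰⇒≥ : ∀ {a b} → ¬ a ≤ b → b ≤ a
  ≰⇒≥ {a} {b} a≰b = [ ⊥-elim ∘ a≰b , id ]′ (total a b)

  <-trans : ∀ {a b c} → a < b → b < c → a < c
  <-trans (a≤b , a≢b) (b≤c , _) = ≤-trans a≤b b≤c , λ { refl → a≢b (≤-antisym a≤b b≤c) }

  ¬Sing⇒FiberNonSingleton : ∀ {g a} → ¬ Sing g a → FiberNonSingleton _≤_ g a
  ¬Sing⇒FiberNonSingleton {g} {a} ¬sing with em {FiberNonSingleton _≤_ g a}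
  ... | yes fns = fns
  ... | no ¬fns = ⊥-elim (¬sing λ c gc≡ga → ¬¬-elim λ c≢a → ¬fns (c , gc≡ga , c≢a))
    where
    ¬¬-elim : ∀ {P : Set} → ¬ ¬ P → P
    ¬¬-elim {P} ¬¬p with em {P}
    ... | yes p = p
    ... | no ¬p = ⊥-elim (¬¬p ¬p)

  FiberNonSingleton⇒¬Sing : ∀ {g a} → FiberNonSingleton _≤_ g a → ¬ Sing g a
  FiberNonSingleton⇒¬Sing (c , gc≡ga , c≢a) sing = c≢a (sing c gc≡ga)

  TopOfFibre BottomOfFibre : (A → A) → A → Set
  TopOfFibre g a = ∀ c → a < c → ¬ g a ≡ g c
  BottomOfFibre g b = ∀ y → y < b → ¬ g y ≡ g b

  Sing⇒TopOfFibre : ∀ {g a} → Sing g a → TopOfFibre g a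
  Sing⇒TopOfFibre sing c (_ , a≢c) ga≡gc = a≢c (sym (sing c (sym ga≡gc)))

  Sing⇒BottomOfFibre : ∀ {g b} → Sing g b → BottomOfFibre g b
  Sing⇒BottomOfFibre sing y (_ , y≢b) gy≡gb = y≢b (sing y gy≡gb)

  Ω⁺-residual : ∀ {l g a} → IsResidual _≤_ l g → Ω⁺ a → TopOfFibre g a → Ω⁺ (g a)
  Ω⁺-residual {g = g} l⊣g up top = (λ _ → proj₁) , λ u u≤ →
    residual-preserves-inf l⊣g up λ c a<c →
      u≤ (g c) (residual-monotone isPreorder l⊣g (proj₁ a<c) , top c a<c)

  Ω⁻-residuated : ∀ {g h b} → IsResidual _≤_ g h → Ω⁻ b → BottomOfFibre g b → Ω⁻ (g b)
  Ω⁻-residuated {g} g⊣h down bottom = (λ _ → proj₁) , λ u ≤u →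
    residuated-preserves-sup g⊣h down λ y y<b →
      ≤u (g y) (residuated-monotone isPreorder g⊣h (proj₁ y<b) , bottom y y<b)

  module Residuated {f h : A → A} (f⊣h : IsResidual _≤_ f h) where

    unit : ∀ {a} → a ≤ h (f a)
    unit = residual-unit isPreorder f⊣h

    counit : ∀ {b} → f (h b) ≤ b
    counit = residual-counit isPreorder f⊣h

    counit<⇒¬Sing : ∀ {b} → f (h b) < b → ¬ Sing h b
    counit<⇒¬Sing {b} (_ , fhb≢b) sing =
      fhb≢b (sing (f (h b)) (≤-antisym (residual-monotone isPreorder f⊣h counit) unit))

    unit<⇒¬Sing : ∀ {a} → a < h (f a) → ¬ Sing f a
    unit<⇒¬Sing {a} (_ , a≢hfa) sing =
      a≢hfa (sym (sing (h (f a)) (≤-antisym counit (residuated-monotone isPreorder f⊣h unit))))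

    unit≡⇒TopOfFibre : ∀ {a} → h (f a) ≡ a → TopOfFibre f a
    unit≡⇒TopOfFibre hfa≡a c a<c fa≡fc =
      <⇒≱ a<c (subst (c ≤_) (trans (cong h (sym fa≡fc)) hfa≡a) unit)

    counit≡⇒BottomOfFibre : ∀ {b} → f (h b) ≡ b → BottomOfFibre h b
    counit≡⇒BottomOfFibre fhb≡b y y<b hy≡hb =
      <⇒≱ y<b (subst (_≤ y) (trans (cong f hy≡hb) fhb≡b) counit)

    counit-≡-on-Ω⁺ : ∀ {l b} → IsResidual _≤_ l f → Ω⁺ (h b) → f (h b) ≡ b
    counit-≡-on-Ω⁺ {b = b} l⊣f up = ≤-antisym counit (residual-preserves-inf l⊣f up b≤f)
      where
      b≤f : ∀ c → h b < c → b ≤ f c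
      b≤f c hb<c = ≰⇒≥ λ fc≤b → <⇒≱ hb<c (proj₁ (f⊣h c b) fc≤b)

    unit-≡-on-Ω⁻ : ∀ {h′ a} → IsResidual _≤_ h h′ → Ω⁻ (f a) → h (f a) ≡ a
    unit-≡-on-Ω⁻ {a = a} h⊣h′ down = ≤-antisym (residuated-preserves-sup h⊣h′ down h≤a) unit
      where
      h≤a : ∀ y → y < f a → h y ≤ a
      h≤a y y<fa = ≰⇒≥ λ a≤hy → <⇒≱ y<fa (proj₂ (f⊣h a y) a≤hy)

    Ω⁺-image⇒Sing : ∀ {l b} → IsResidual _≤_ l f → Ω⁺ (h b) → Sing h b
    Ω⁺-image⇒Sing {b = b} l⊣f up c hc≡hb = begin
      c        ≡⟨ counit-≡-on-Ω⁺ l⊣f (subst Ω⁺ (sym hc≡hb) up) ⟨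
      f (h c)  ≡⟨ cong f hc≡hb ⟩
      f (h b)  ≡⟨ counit-≡-on-Ω⁺ l⊣f up ⟩
      b        ∎
      where open ≡-Reasoning

    Ω⁻-image⇒Sing : ∀ {h′ a} → IsResidual _≤_ h h′ → Ω⁻ (f a) → Sing f a
    Ω⁻-image⇒Sing {a = a} h⊣h′ down c fc≡fa = begin
      c        ≡⟨ unit-≡-on-Ω⁻ h⊣h′ (subst Ω⁻ (sym fc≡fa) down) ⟨
      h (f c)  ≡⟨ cong h fc≡fa ⟩
      h (f a)  ≡⟨ unit-≡-on-Ω⁻ h⊣h′ down ⟩
      a        ∎
      where open ≡-Reasoning

  -- x ≤̄ y unfolds definitionally to Lex (pt x) (idx x) (pt y) (idx y).
  Lex : A → ℤ → A → ℤ → Set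
  Lex a k b n = a < b ⊎ (a ≡ b × k ≤ℤ n)

  Lex-intro : ∀ {a k b n} → a ≤ b → (a ≡ b → k ≤ℤ n) → Lex a k b n
  Lex-intro {a} {b = b} a≤b k≤n with em {a ≡ b}
  ... | yes a≡b = inj₂ (a≡b , k≤n a≡b)
  ... | no a≢b = inj₁ (a≤b , a≢b)

  Lex⇒≤ : ∀ {a k b n} → Lex a k b n → a ≤ b
  Lex⇒≤ (inj₁ (a≤b , _)) = a≤b
  Lex⇒≤ (inj₂ (refl , _)) = ≤-refl

  Lex⇒idx : ∀ {a k b n} → Lex a k b n → a ≡ b → k ≤ℤ n
  Lex⇒idx (inj₁ (_ , a≢b)) a≡b = ⊥-elim (a≢b a≡b)
  Lex⇒idx (inj₂ (_ , k≤n)) _ = k≤n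

  Lex-trans : ∀ {a k b n c m} → Lex a k b n → Lex b n c m → Lex a k c m
  Lex-trans (inj₁ a<b) (inj₁ b<c) = inj₁ (<-trans a<b b<c)
  Lex-trans (inj₁ a<b) (inj₂ (refl , _)) = inj₁ a<b
  Lex-trans (inj₂ (refl , _)) (inj₁ b<c) = inj₁ b<c
  Lex-trans (inj₂ (refl , k≤n)) (inj₂ (refl , n≤m)) = inj₂ (refl , ℤ.≤-trans k≤n n≤m)

  ≤̄-isPreorder : IsPreorder _≡_ _≤̄_
  ≤̄-isPreorder = record
    { isEquivalence = isEquivalence
    ; reflexive     = λ { refl → inj₂ (refl , ℤ.≤-refl) }
    ; trans         = Lex-trans
    }

  validity : (x : Ω̄) → ValidBar _≤_ (idx x) (pt x)
  validity (bar _ _ v) = recompute em v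

  ¬Ω⁺⇒idx≤0 : ∀ {k a} → ValidBar _≤_ k a → ¬ Ω⁺ a → k ≤ℤ + 0
  ¬Ω⁺⇒idx≤0 (up , _) ¬up = ℤ.≮⇒≥ (¬up ∘ up)

  ¬Ω⁻⇒0≤idx : ∀ {k a} → ValidBar _≤_ k a → ¬ Ω⁻ a → + 0 ≤ℤ k
  ¬Ω⁻⇒0≤idx (_ , down) ¬down = ℤ.≮⇒≥ (¬down ∘ down)

  IndexRule : (A → A) → A → ℤ → ℤ → Set
  IndexRule g a k k′ = (Sing g a → k′ ≡ k) × (¬ Sing g a → k′ ≡ + 0)

  IndexRule-functional : ∀ {g a k k′ k″} → IndexRule g a k k′ → IndexRule g a k k″ → k′ ≡ k″
  IndexRule-functional {g} {a} ρ ρ′ with em {Sing g a}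
  ... | yes sing = trans (proj₁ ρ sing) (sym (proj₁ ρ′ sing))
  ... | no ¬sing = trans (proj₂ ρ ¬sing) (sym (proj₂ ρ′ ¬sing))

  IndexRule-≤0 : ∀ {g a k k′} → IndexRule g a k k′ → k ≤ℤ + 0 → k′ ≤ℤ + 0
  IndexRule-≤0 {g} {a} ρ k≤0 with em {Sing g a}
  ... | yes sing = subst (_≤ℤ + 0) (sym (proj₁ ρ sing)) k≤0
  ... | no ¬sing = ℤ.≤-reflexive (proj₂ ρ ¬sing)

  IndexRule-0≤ : ∀ {g a k k′} → IndexRule g a k k′ → + 0 ≤ℤ k → + 0 ≤ℤ k′
  IndexRule-0≤ {g} {a} ρ 0≤k with em {Sing g a}
  ... | yes sing = subst (+ 0 ≤ℤ_) (sym (proj₁ ρ sing)) 0≤k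
  ... | no ¬sing = ℤ.≤-reflexive (sym (proj₂ ρ ¬sing))

  graph⇒IndexRule : ∀ {g x y} → FBarGraph _≤_ g x y →
                    pt y ≡ g (pt x) × IndexRule g (pt x) (idx x) (idx y)
  graph⇒IndexRule (inj₁ (inj₁ fns , y≡0 , py)) =
    py , (⊥-elim ∘ FiberNonSingleton⇒¬Sing fns) , const y≡0
  graph⇒IndexRule (inj₁ (inj₂ x≡0 , y≡0 , py)) = py , const (trans y≡0 (sym x≡0)) , const y≡0
  graph⇒IndexRule (inj₂ (sing , _ , y≡x , py)) = py , const y≡x , λ ¬sing → ⊥-elim (¬sing sing)

  graph-functional : ∀ {g x y y′} → FBarGraph _≤_ g x y → FBarGraph _≤_ g x y′ → y ≡ y′
  graph-functional {g} {x} {y@(bar _ _ _)} {y′@(bar _ _ _)} gy gy′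
    with graph⇒IndexRule {g} {x} {y} gy | graph⇒IndexRule {g} {x} {y′} gy′
  ... | refl , ρ | refl , ρ′ with IndexRule-functional ρ ρ′
  ...   | refl = refl

  module Extension {l f h : A → A} (l⊣f : IsResidual _≤_ l f) (f⊣h : IsResidual _≤_ f h) where

    extend : Ω̄ → Ω̄
    extend (bar k a v) with em {Sing f a}
    ... | yes sing = bar k (f a)
          ( (λ 0<k → Ω⁺-residual l⊣f (proj₁ v 0<k) (Sing⇒TopOfFibre sing))
          , (λ k<0 → Ω⁻-residuated f⊣h (proj₂ v k<0) (Sing⇒BottomOfFibre sing)))
    ... | no _ = bar (+ 0) (f a) ((λ { (+<+ ()) }) , (λ { (+<+ ()) }))

    extend-graph : ∀ x → FBarGraph _≤_ f x (extend x)
    extend-graph (bar k a v) with em {Sing f a}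
    ... | no ¬sing = inj₁ (inj₁ (¬Sing⇒FiberNonSingleton ¬sing) , refl , refl)
    ... | yes sing with k ℤ.≟ + 0
    ...   | yes k≡0 = inj₁ (inj₂ k≡0 , k≡0 , refl)
    ...   | no k≢0 = inj₂ (sing , k≢0 , refl , refl)

  module Lifting {l′ l f h h′ h″ : A → A}
    (l′⊣l : IsResidual _≤_ l′ l) (l⊣f : IsResidual _≤_ l f) (f⊣h : IsResidual _≤_ f h)
    (h⊣h′ : IsResidual _≤_ h h′) (h′⊣h″ : IsResidual _≤_ h′ h″) where
    open Residuated f⊣h

    fixed-pair-Sing : ∀ {a} → h (f a) ≡ a → Ω⁺ a ⊎ Ω⁻ (f a) → Sing f a × Sing h (f a)
    fixed-pair-Sing hfa≡a (inj₁ up) =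
        Residuated.Ω⁺-image⇒Sing l⊣f l′⊣l (Ω⁺-residual l⊣f up (unit≡⇒TopOfFibre hfa≡a))
      , Ω⁺-image⇒Sing l⊣f (subst Ω⁺ (sym hfa≡a) up)
    fixed-pair-Sing hfa≡a (inj₂ down) =
        Ω⁻-image⇒Sing h⊣h′ down
      , Residuated.Ω⁻-image⇒Sing h⊣h′ h′⊣h″
          (Ω⁻-residuated h⊣h′ down (counit≡⇒BottomOfFibre (cong f hfa≡a)))

    fixed-pair-idx : ∀ {a k b n k′ n′} → f a ≡ b → h b ≡ a →
      ValidBar _≤_ k a → ValidBar _≤_ n b → IndexRule f a k k′ → IndexRule h b n n′ →
      (k′ ≤ℤ n → k ≤ℤ n′) × (k ≤ℤ n′ → k′ ≤ℤ n)
    fixed-pair-idx {a} refl hfa≡a va vb ρ σ with em {Sing f a × Sing h (f a)}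
    ... | yes (sf , sh) with proj₁ ρ sf | proj₁ σ sh
    ...   | refl | refl = id , id
    fixed-pair-idx {a} {k} {n = n} refl hfa≡a va vb ρ σ | no ¬both =
      const (ℤ.≤-trans k≤0 (IndexRule-0≤ σ 0≤n)) , const (ℤ.≤-trans (IndexRule-≤0 ρ k≤0) 0≤n)
      where
      k≤0 : k ≤ℤ + 0
      k≤0 = ¬Ω⁺⇒idx≤0 va (¬both ∘ fixed-pair-Sing hfa≡a ∘ inj₁)
      0≤n : + 0 ≤ℤ n
      0≤n = ¬Ω⁻⇒0≤idx vb (¬both ∘ fixed-pair-Sing hfa≡a ∘ inj₂)

    a≡hb⇒k≤n′ : ∀ {a k b n k′ n′} → ValidBar _≤_ k a → ValidBar _≤_ n b →
      IndexRule f a k k′ → IndexRule h b n n′ → Lex (f a) k′ b n → a ≡ h b → k ≤ℤ n′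
    a≡hb⇒k≤n′ {b = b} va vb ρ σ lhs refl with em {f (h b) ≡ b}
    ... | yes fhb≡b = proj₁ (fixed-pair-idx fhb≡b refl va vb ρ σ) (Lex⇒idx lhs fhb≡b)
    ... | no fhb≢b =
      ℤ.≤-trans (¬Ω⁺⇒idx≤0 va (¬sing ∘ Ω⁺-image⇒Sing l⊣f)) (ℤ.≤-reflexive (sym (proj₂ σ ¬sing)))
      where
      ¬sing : ¬ Sing h b
      ¬sing = counit<⇒¬Sing (Lex⇒≤ lhs , fhb≢b)

    fa≡b⇒k′≤n : ∀ {a k b n k′ n′} → ValidBar _≤_ k a → ValidBar _≤_ n b →
      IndexRule f a k k′ → IndexRule h b n n′ → Lex a k (h b) n′ → f a ≡ b → k′ ≤ℤ n
    fa≡b⇒k′≤n {a} va vb ρ σ rhs refl with em {a ≡ h (f a)}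
    ... | yes a≡hfa = proj₂ (fixed-pair-idx refl (sym a≡hfa) va vb ρ σ) (Lex⇒idx rhs a≡hfa)
    ... | no a≢hfa =
      ℤ.≤-trans (ℤ.≤-reflexive (proj₂ ρ ¬sing)) (¬Ω⁻⇒0≤idx vb (¬sing ∘ Ω⁻-image⇒Sing h⊣h′))
      where
      ¬sing : ¬ Sing f a
      ¬sing = unit<⇒¬Sing (Lex⇒≤ rhs , a≢hfa)

    lift-residuation : ∀ {a k b n k′ n′} → ValidBar _≤_ k a → ValidBar _≤_ n b →
      IndexRule f a k k′ → IndexRule h b n n′ →
      (Lex (f a) k′ b n → Lex a k (h b) n′) × (Lex a k (h b) n′ → Lex (f a) k′ b n)
    lift-residuation {a} {b = b} va vb ρ σ =
        (λ lhs → Lex-intro (proj₁ (f⊣h a b) (Lex⇒≤ lhs)) (a≡hb⇒k≤n′ va vb ρ σ lhs))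
      , (λ rhs → Lex-intro (proj₂ (f⊣h a b) (Lex⇒≤ rhs)) (fa≡b⇒k′≤n va vb ρ σ rhs))

    graph-residuation : ∀ {x x′ y y′} → FBarGraph _≤_ f x x′ → FBarGraph _≤_ h y y′ →
      (x′ ≤̄ y → x ≤̄ y′) × (x ≤̄ y′ → x′ ≤̄ y)
    graph-residuation {x} {x′@(bar _ _ _)} {y} {y′@(bar _ _ _)} gx gy
      with graph⇒IndexRule {f} {x} {x′} gx | graph⇒IndexRule {h} {y} {y′} gy
    ... | refl , ρ | refl , σ = lift-residuation (validity x) (validity y) ρ σ

  module _ {s : ℤ → A → A} (s-residuated : ResiduatedChain _≤_ s) where

    s-residuatedˡ : ∀ i → IsResidual _≤_ (s (predℤ i)) (s i)
    s-residuatedˡ = residuated-pred s-residuated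

    lifted-chain : ℤ → Ω̄ → Ω̄
    lifted-chain i = Extension.extend (s-residuatedˡ i) (s-residuated i)

    lifted-chain-graph : ∀ i x → FBarGraph _≤_ (s i) x (lifted-chain i x)
    lifted-chain-graph i = Extension.extend-graph (s-residuatedˡ i) (s-residuated i)

    lifted-chain-residuated : ResiduatedChain _≤̄_ lifted-chain
    lifted-chain-residuated i x y =
      Lifting.graph-residuation
        (s-residuatedˡ (predℤ i)) (s-residuatedˡ i) (s-residuated i)
        (s-residuated (sucℤ i)) (s-residuated (sucℤ (sucℤ i)))
        {x} {lifted-chain i x} {y} {lifted-chain (sucℤ i) y}
        (lifted-chain-graph i x) (lifted-chain-graph (sucℤ i) y)

lemma2p9 : ExcludedMiddle 0ℓ →
    (A : Set) (_≤_ : A → A → Set) → IsTotalOrder _≡_ _≤_ →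
    (f : A → A) → InF _≤_ f →
    Σ (Bar _≤_ → Bar _≤_) λ g →
      (∀ x → FBarGraph _≤_ f x (g x))
      × (∀ x y → FBarGraph _≤_ f x y → y ≡ g x)
      × InF (_≤Bar_ _≤_) g
lemma2p9 em A _≤_ ≤-isTotalOrder f F =
    lifted-chain f-chain (+ 0)
  , lifted-chain-graph f-chain (+ 0)
  , (λ x y graph → graph-functional {f} {x} graph (lifted-chain-graph f-chain (+ 0) x))
  , chain⇒InF _≤̄_ ≤̄-isPreorder {lifted-chain f-chain} (lifted-chain-residuated f-chain)
  where
  open OnChain em ≤-isTotalOrder
  open Residuation using (chain; chain-residuated; chain⇒InF)
  f-chain : ResiduatedChain _≤_ (chain _≤_ F)
  f-chain = chain-residuated _≤_ F
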